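{- For every $n\ge1$, the number of decomposable affine permutations of size $n$, namely $|\{\Sigma^r(\oplus\pi):\pi\in S_n,\ r\in\mathbb{Z}\}|$, equals the number of sum-indecomposable permutations in $S_{n+1}$.
   Context: For $\pi\in S_n$, the infinite sum $\oplus\pi:\mathbb{Z}\to\mathbb{Z}$ is defined by $\oplus\pi(i+kn)=\pi(i)+kn$ for $i\in[n]$ and $k\in\mathbb{Z}$. For a bijection $\sigma$ of $\mathbb{Z}$ and $r\in\mathbb{Z}$, $\Sigma^r\sigma(i)=\sigma(i-r)+r$. The sum $\sigma\oplus\tau$ of $\sigma\in S_a$ and $\tau\in S_b$ is the permutation of $[a+b]$ equal to $\sigma(i)$ for $i\le a$ and to $a+\tau(i-a)$ for $i>a$. A permutation is sum-indecomposable if it is not a sum of two permutations of nonzero size. -}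

module Defs where

open import Data.Nat as ℕ using (ℕ; zero; suc; NonZero)
open import Data.Integer as ℤ using (ℤ; +_; _+_; _-_; _*_)
open import Data.Integer.DivMod using (_%ℕ_; _/ℕ_; n%ℕd<d)
open import Data.Fin as Fin using (Fin; toℕ; fromℕ<; cast; splitAt; _↑ˡ_; _↑ʳ_)
open import Data.Fin.Permutation using (Permutation′; _⟨$⟩ʳ_)
open import Data.Sum using (inj₁; inj₂)
open import Data.Product using (Σ; ∃; _×_; _,_)
open import Relation.Binary.PropositionalEquality using (_≡_; sym)
open import Relation.Nullary using (¬_)
open import Data.Unit using (⊤)

-- A set, given as a predicate P on a carrier A considered up to an
-- equivalence _≈_ (the equality of the objects the paper talks about),
-- has exactly m elements: there is an enumeration Fin m → A of elements
-- of P that is injective up to ≈ and hits every element of P up to ≈.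
HasCard : {A : Set} → (A → A → Set) → (A → Set) → ℕ → Set
HasCard {A} _≈_ P m =
  Σ (Fin m → A) λ v →
    (∀ i → P (v i)) ×
    (∀ i j → v i ≈ v j → i ≡ j) ×
    (∀ a → P a → ∃ λ i → v i ≈ a)

-- The infinite sum ⊕π : ℤ → ℤ of π ∈ S_n (paper's [n] = {1..n} is
-- represented by Fin n via i ↦ i+1):  ⊕π(i + k n) = π(i) + k n, i ∈ [n].
-- For z ∈ ℤ write z - 1 = j + k n with 0 ≤ j < n, so z = (j+1) + k n.
infSum : (n : ℕ) .{{_ : NonZero n}} → Permutation′ n → ℤ → ℤ
infSum n π z =
  + suc (toℕ (π ⟨$⟩ʳ fromℕ< (n%ℕd<d (z - + 1) n))) + ((z - + 1) /ℕ n) * + n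

Shift : ℤ → (ℤ → ℤ) → ℤ → ℤ
Shift r σ i = σ (i - r) + r

-- Decomposable affine permutations of size n, parametrised by (π , r);
-- two parameters give the same affine permutation iff the bijections of
-- ℤ agree pointwise.
affineOf : (n : ℕ) .{{_ : NonZero n}} → Permutation′ n × ℤ → ℤ → ℤ
affineOf n (π , r) = Shift r (infSum n π)

SameAffine : (n : ℕ) .{{_ : NonZero n}} → (Permutation′ n × ℤ) → (Permutation′ n × ℤ) → Set
SameAffine n p q = ∀ z → affineOf n p z ≡ affineOf n q z

AllParams : {n : ℕ} → Permutation′ n × ℤ → Set
AllParams _ = ⊤

SamePerm : {N : ℕ} → Permutation′ N → Permutation′ N → Set
SamePerm π ρ = ∀ i → π ⟨$⟩ʳ i ≡ ρ ⟨$⟩ʳ i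

directSum : {a b : ℕ} → Permutation′ a → Permutation′ b → Fin (a ℕ.+ b) → Fin (a ℕ.+ b)
directSum {a} {b} σ τ i with splitAt a i
... | inj₁ x = (σ ⟨$⟩ʳ x) ↑ˡ b
... | inj₂ y = a ↑ʳ (τ ⟨$⟩ʳ y)

SumDecomposable : {N : ℕ} → Permutation′ N → Set
SumDecomposable {N} π =
  Σ ℕ λ a → Σ ℕ λ b → Σ (a ℕ.+ b ≡ N) λ e →
    NonZero a × NonZero b ×
    Σ (Permutation′ a) λ σ → Σ (Permutation′ b) λ τ →
      ∀ i → π ⟨$⟩ʳ i ≡ cast e (directSum σ τ (cast (sym e) i))

SumIndecomposable : {N : ℕ} → Permutation′ N → Set
SumIndecomposable π = ¬ SumDecomposable π

module Submission where

-- Write p for the position of the maximal letter n + 1 in τ ∈ S_{n+1}, and π ∈ S_n for τ with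
-- that letter deleted; the bijection is τ ↦ Σ^{-p}(⊕π).  Everything rests on reading ⊕π through
-- another window: for 0 ≤ d ≤ n, Σ^{r+d}(⊕σ) = Σ^r(⊕π) holds exactly when π = α ⊕ β with
-- |α| = d and σ = β ⊕ α.  Injectivity: if two indecomposable τ, τ′ with p < p′ had the same
-- image, π′ would split at p′ - p ≤ p′, and inserting n + 1 at position p′ keeps that split, so
-- τ′ would be decomposable.  Surjectivity: by periodicity every decomposable affine permutation
-- is Σ^{-p₀}(⊕π) with 0 ≤ p₀ < n; take the largest split point d ≤ p₀ of π, rewrite it as
-- Σ^{-(p₀-d)}(⊕σ) with σ the rotation, and insert n + 1 into σ at position p₀ - d.  A split
-- point e of the resulting τ must satisfy e ≤ p₀ - d, and then d + e would be a split point of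
-- π in (d, p₀].

open import Defs
open import Data.Nat using (ℕ; suc; NonZero)
open import Data.Product using (∃; _×_)

open import Data.Product using (_,_; proj₁; proj₂; ∃₂)
open import Data.Sum using (inj₁; inj₂)
open import Data.Unit using (tt)
open import Data.Fin as Fin using (Fin; toℕ; fromℕ<; cast; splitAt; join; _↑ˡ_; _↑ʳ_; punchIn; punchOut)
import Data.Fin.Properties as Finₚ
open import Data.Fin.Permutation as Perm
  using (Permutation′; _⟨$⟩ʳ_; _⟨$⟩ˡ_; permutation; flip; _∘ₚ_; inverseˡ; inverseʳ;
         remove; insert; punchIn-permute; insert-remove; remove-insert)
import Data.Vec.Functional as Vector
open import Data.List using (List; []; _∷_; allFin; cartesianProductWith)
open import Data.List.Membership.Propositional using (_∈_)
open import Data.List.Membership.Propositional.Properties using (∈-allFin; ∈-cartesianProductWith⁺)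
open import Data.List.Relation.Unary.Any using (here; there)
open import Function.Bundles using (_⇔_; mk⇔; module Equivalence)
import Function.Properties.Equivalence as ⇔
open import Relation.Binary using (Transitive; IsDecEquivalence; tri<; tri≈; tri>)
open import Relation.Binary.PropositionalEquality
open import Relation.Nullary using (Dec; yes; no; ¬_)
import Relation.Nullary.Decidable as Dec
open import Relation.Nullary.Decidable using (_×-dec_; ¬?)
open import Relation.Nullary.Negation using (contradiction)
open import Relation.Unary using (Decidable)

open Equivalence using (to; from)

module _ {A : Set} {_≈_ : A → A → Set} (≈-isDecEquivalence : IsDecEquivalence _≈_)
         {P : A → Set} (P? : Decidable P) (P-resp : ∀ a b → a ≈ b → P a → P b) where

  open IsDecEquivalence ≈-isDecEquivalence using () renaming (_≟_ to _≈?_; refl to ≈-refl; sym to ≈-sym; trans to ≈-trans)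

  Listed : List A → A → Set
  Listed xs a = P a × a ∈ xs

  private
    hasCard-∷-covered : ∀ {x xs m} (c : HasCard _≈_ (Listed xs) m) → (P x → ∃ λ i → proj₁ c i ≈ x) →
                        HasCard _≈_ (Listed (x ∷ xs)) m
    hasCard-∷-covered {x} {xs} (v , Pv , v-inj , v-onto) covered =
      v , (λ i → proj₁ (Pv i) , there (proj₂ (Pv i))) , v-inj , onto
      where
      onto : ∀ a → Listed (x ∷ xs) a → ∃ λ i → v i ≈ a
      onto a (Pa , here refl)  = covered Pa
      onto a (Pa , there a∈xs) = v-onto a (Pa , a∈xs)

    hasCard-∷-new : ∀ {x xs m} (c : HasCard _≈_ (Listed xs) m) → P x → ¬ (∃ λ i → proj₁ c i ≈ x) →
                    HasCard _≈_ (Listed (x ∷ xs)) (suc m)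
    hasCard-∷-new {x} {xs} (v , Pv , v-inj , v-onto) Px x∉v = x Vector.∷ v , Pv′ , inj , onto
      where
      Pv′ : ∀ i → Listed (x ∷ xs) ((x Vector.∷ v) i)
      Pv′ Fin.zero    = Px , here refl
      Pv′ (Fin.suc i) = proj₁ (Pv i) , there (proj₂ (Pv i))

      inj : ∀ i j → (x Vector.∷ v) i ≈ (x Vector.∷ v) j → i ≡ j
      inj Fin.zero    Fin.zero    _     = refl
      inj Fin.zero    (Fin.suc j) x≈vj  = contradiction (j , ≈-sym x≈vj) x∉v
      inj (Fin.suc i) Fin.zero    vi≈x  = contradiction (i , vi≈x) x∉v
      inj (Fin.suc i) (Fin.suc j) vi≈vj = cong Fin.suc (v-inj i j vi≈vj)

      onto : ∀ a → Listed (x ∷ xs) a → ∃ λ i → (x Vector.∷ v) i ≈ a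
      onto a (Pa , here refl)  = Fin.zero , ≈-refl
      onto a (Pa , there a∈xs) = let (i , vi≈a) = v-onto a (Pa , a∈xs) in Fin.suc i , vi≈a

  hasCard-members : ∀ xs → ∃ λ m → HasCard _≈_ (Listed xs) m
  hasCard-members []       = 0 , (λ ()) , (λ ()) , (λ ()) , (λ _ ())
  hasCard-members (x ∷ xs) with hasCard-members xs
  ... | m , c with Finₚ.any? (λ i → proj₁ c i ≈? x) | P? x
  ... | yes x∈c | _      = m , hasCard-∷-covered c (λ _ → x∈c)
  ... | no _    | no ¬Px = m , hasCard-∷-covered c (λ Px → contradiction Px ¬Px)
  ... | no x∉c  | yes Px = suc m , hasCard-∷-new c Px x∉c

  hasCard-fromList : ∀ xs → (∀ a → ∃ λ x → x ∈ xs × x ≈ a) → ∃ λ m → HasCard _≈_ P m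
  hasCard-fromList xs complete with hasCard-members xs
  ... | m , v , Pv , v-inj , v-onto = m , v , (λ i → proj₁ (Pv i)) , v-inj , onto
    where
    onto : ∀ a → P a → ∃ λ i → v i ≈ a
    onto a Pa with complete a
    ... | x , x∈xs , x≈a with v-onto x (P-resp a x (≈-sym x≈a) Pa , x∈xs)
    ... | i , vi≈x = i , ≈-trans vi≈x x≈a

hasCard-transfer : ∀ {A B : Set} {_≈ᴬ_ : A → A → Set} {_≈ᴮ_ : B → B → Set} {P : A → Set} {Q : B → Set} {m} →
                   Transitive _≈ᴬ_ → (f : B → A) →
                   (∀ b → Q b → P (f b)) →
                   (∀ b b′ → Q b → Q b′ → f b ≈ᴬ f b′ → b ≈ᴮ b′) →
                   (∀ a → P a → ∃ λ b → Q b × f b ≈ᴬ a) →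
                   (∀ b b′ → b ≈ᴮ b′ → f b ≈ᴬ f b′) →
                   HasCard _≈ᴮ_ Q m → HasCard _≈ᴬ_ P m
hasCard-transfer {_≈ᴬ_ = _≈ᴬ_} {P = P} ≈ᴬ-trans f f-P f-injective f-surjective f-cong (v , Qv , v-inj , v-onto) =
  (λ i → f (v i)) , (λ i → f-P (v i) (Qv i)) ,
  (λ i j fvi≈fvj → v-inj i j (f-injective (v i) (v j) (Qv i) (Qv j) fvi≈fvj)) , onto
  where
  onto : ∀ a → P a → ∃ λ i → f (v i) ≈ᴬ a
  onto a Pa with f-surjective a Pa
  ... | b , Qb , fb≈a with v-onto b Qb
  ... | i , vi≈b = i , ≈ᴬ-trans (f-cong (v i) b vi≈b) fb≈a

module Permutations where
  open import Data.Nat using (zero; _+_; _∸_; _<_; _≤_; _<?_; _≤?_; z≤n; s≤s; s≤s⁻¹; >-nonZero; >-nonZero⁻¹)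
  open import Data.Nat.Properties

  -- Junk value 0 outside [0, N).
  ⌊_⌋ : ∀ {N} → Permutation′ N → ℕ → ℕ
  ⌊_⌋ {N} π j with j <? N
  ... | yes j<N = toℕ (π ⟨$⟩ʳ fromℕ< j<N)
  ... | no _    = 0

  ⌊⌋-fromℕ< : ∀ {N} (π : Permutation′ N) {j} (j<N : j < N) → ⌊ π ⌋ j ≡ toℕ (π ⟨$⟩ʳ fromℕ< j<N)
  ⌊⌋-fromℕ< {N} π {j} j<N with j <? N
  ... | yes _   = refl
  ... | no j≮N = contradiction j<N j≮N

  ⌊⌋-toℕ : ∀ {N} (π : Permutation′ N) x → ⌊ π ⌋ (toℕ x) ≡ toℕ (π ⟨$⟩ʳ x)
  ⌊⌋-toℕ π x = trans (⌊⌋-fromℕ< π (Finₚ.toℕ<n x)) (cong (λ y → toℕ (π ⟨$⟩ʳ y)) (Finₚ.fromℕ<-toℕ x _))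

  ⌊⌋-< : ∀ {N} (π : Permutation′ N) {j} → j < N → ⌊ π ⌋ j < N
  ⌊⌋-< π j<N = subst (_< _) (sym (⌊⌋-fromℕ< π j<N)) (Finₚ.toℕ<n _)

  ⌊⌋-inverse : ∀ {N} (π : Permutation′ N) {j} → j < N → ⌊ flip π ⌋ (⌊ π ⌋ j) ≡ j
  ⌊⌋-inverse π {j} j<N = begin
    ⌊ flip π ⌋ (⌊ π ⌋ j)                 ≡⟨ cong ⌊ flip π ⌋ (⌊⌋-fromℕ< π j<N) ⟩
    ⌊ flip π ⌋ (toℕ (π ⟨$⟩ʳ fromℕ< j<N)) ≡⟨ ⌊⌋-toℕ (flip π) _ ⟩
    toℕ (π ⟨$⟩ˡ (π ⟨$⟩ʳ fromℕ< j<N))     ≡⟨ cong toℕ (inverseˡ π) ⟩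
    toℕ (fromℕ< j<N)                     ≡⟨ Finₚ.toℕ-fromℕ< j<N ⟩
    j                                    ∎
    where open ≡-Reasoning

  ⌊⌋-cong : ∀ {N} {σ π : Permutation′ N} → SamePerm σ π → ∀ {j} → j < N → ⌊ σ ⌋ j ≡ ⌊ π ⌋ j
  ⌊⌋-cong {σ = σ} {π} σ≈π j<N = trans (⌊⌋-fromℕ< σ j<N) (trans (cong toℕ (σ≈π _)) (sym (⌊⌋-fromℕ< π j<N)))

  ⌊∘ₚ⌋ : ∀ {N} (π ρ : Permutation′ N) {j} → j < N → ⌊ π ∘ₚ ρ ⌋ j ≡ ⌊ ρ ⌋ (⌊ π ⌋ j)
  ⌊∘ₚ⌋ π ρ j<N = trans (⌊⌋-fromℕ< (π ∘ₚ ρ) j<N) (trans (sym (⌊⌋-toℕ ρ _)) (cong ⌊ ρ ⌋ (sym (⌊⌋-fromℕ< π j<N))))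

  module _ {m : ℕ} (f g : ℕ → ℕ)
           (f-< : ∀ {j} → j < m → f j < m) (g-< : ∀ {j} → j < m → g j < m)
           (g∘f : ∀ {j} → j < m → g (f j) ≡ j) (f∘g : ∀ {j} → j < m → f (g j) ≡ j) where

    private
      finite : ∀ {h : ℕ → ℕ} → (∀ {j} → j < m → h j < m) → Fin m → Fin m
      finite h-< x = fromℕ< (h-< (Finₚ.toℕ<n x))

      finite-inverse : ∀ {h k : ℕ → ℕ} (h-< : ∀ {j} → j < m → h j < m) (k-< : ∀ {j} → j < m → k j < m) →
                       (∀ {j} → j < m → k (h j) ≡ j) → ∀ x → finite k-< (finite h-< x) ≡ x
      finite-inverse {h} {k} h-< k-< k∘h x = Finₚ.toℕ-injective (begin
        toℕ (finite k-< (finite h-< x))  ≡⟨ Finₚ.toℕ-fromℕ< _ ⟩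
        k (toℕ (finite h-< x))           ≡⟨ cong k (Finₚ.toℕ-fromℕ< _) ⟩
        k (h (toℕ x))                    ≡⟨ k∘h (Finₚ.toℕ<n x) ⟩
        toℕ x                            ∎)
        where open ≡-Reasoning

    opaque
      permFromℕ : Permutation′ m
      permFromℕ = permutation (finite f-<) (finite g-<) (finite-inverse g-< f-< f∘g) (finite-inverse f-< g-< g∘f)

      ⌊permFromℕ⌋ : ∀ {j} → j < m → ⌊ permFromℕ ⌋ j ≡ f j
      ⌊permFromℕ⌋ j<m = trans (⌊⌋-fromℕ< permFromℕ j<m) (trans (Finₚ.toℕ-fromℕ< _) (cong f (Finₚ.toℕ-fromℕ< j<m)))

      ⌊flip-permFromℕ⌋ : ∀ {j} → j < m → ⌊ flip permFromℕ ⌋ j ≡ g j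
      ⌊flip-permFromℕ⌋ j<m = trans (⌊⌋-fromℕ< (flip permFromℕ) j<m) (trans (Finₚ.toℕ-fromℕ< _) (cong g (Finₚ.toℕ-fromℕ< j<m)))

  record SplitsAt {N} (π : Permutation′ N) (d : ℕ) : Set where
    constructor splitting
    field
      below-⇔ : ∀ x → toℕ x < d ⇔ toℕ (π ⟨$⟩ʳ x) < d

  open SplitsAt public

  private
    both : ∀ {A B : Set} → A → B → A ⇔ B
    both a b = mk⇔ (λ _ → b) (λ _ → a)

    neither : ∀ {A B : Set} → ¬ A → ¬ B → A ⇔ B
    neither ¬a ¬b = mk⇔ (λ a → contradiction a ¬a) (λ b → contradiction b ¬b)

    _⇔?_ : ∀ {A B : Set} → Dec A → Dec B → Dec (A ⇔ B)
    yes a ⇔? yes b = yes (both a b)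
    no ¬a ⇔? no ¬b = yes (neither ¬a ¬b)
    yes a ⇔? no ¬b = no (λ a⇔b → ¬b (to a⇔b a))
    no ¬a ⇔? yes b = no (λ a⇔b → ¬a (from a⇔b b))

  splitsAt? : ∀ {N} (π : Permutation′ N) d → Dec (SplitsAt π d)
  splitsAt? π d = Dec.map′ splitting below-⇔ (Finₚ.all? λ x → (toℕ x <? d) ⇔? (toℕ (π ⟨$⟩ʳ x) <? d))

  splitsAtℕ : ∀ {N} {π : Permutation′ N} {d} → SplitsAt π d → ∀ {j} → j < N → j < d ⇔ ⌊ π ⌋ j < d
  splitsAtℕ {π = π} {d} s j<N =
    subst₂ (λ a b → a < d ⇔ b < d) (Finₚ.toℕ-fromℕ< j<N) (sym (⌊⌋-fromℕ< π j<N)) (below-⇔ s (fromℕ< j<N))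

  splitsAt-fromℕ : ∀ {N} {π : Permutation′ N} {d} → (∀ {j} → j < N → j < d ⇔ ⌊ π ⌋ j < d) → SplitsAt π d
  splitsAt-fromℕ {π = π} {d} s = splitting λ x → subst (λ b → toℕ x < d ⇔ b < d) (⌊⌋-toℕ π x) (s (Finₚ.toℕ<n x))

  splitsAt-flip : ∀ {N} {π : Permutation′ N} {d} → SplitsAt π d → SplitsAt (flip π) d
  splitsAt-flip {π = π} {d} s = splitting λ x →
    ⇔.sym (subst (λ y → toℕ (π ⟨$⟩ˡ x) < d ⇔ toℕ y < d) (inverseʳ π) (below-⇔ s (π ⟨$⟩ˡ x)))

  splitsAt-cong : ∀ {N} {π ρ : Permutation′ N} {d} → SamePerm π ρ → SplitsAt π d → SplitsAt ρ d
  splitsAt-cong {d = d} π≈ρ s = splitting λ x → subst (λ y → toℕ x < d ⇔ toℕ y < d) (π≈ρ x) (below-⇔ s x)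

  splitsAt-zero : ∀ {N} (π : Permutation′ N) → SplitsAt π 0
  splitsAt-zero π = splitting λ x → neither (λ ()) (λ ())

  splitsAt-≥ : ∀ {N} {π : Permutation′ N} {d} → SplitsAt π d → ∀ {j} → j < N → d ≤ j → d ≤ ⌊ π ⌋ j
  splitsAt-≥ s j<N d≤j = ≮⇒≥ (λ πj<d → <⇒≱ (from (splitsAtℕ s j<N) πj<d) d≤j)

  greatest-≤ : ∀ {Q : ℕ → Set} → Decidable Q → Q 0 → ∀ m →
               ∃ λ d → d ≤ m × Q d × (∀ {d′} → d < d′ → d′ ≤ m → ¬ Q d′)
  greatest-≤ Q? Q0 zero = 0 , z≤n , Q0 , λ 0<d′ d′≤0 → contradiction d′≤0 (<⇒≱ 0<d′)
  greatest-≤ {Q} Q? Q0 (suc m) with Q? (suc m)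
  ... | yes Q[1+m] = suc m , ≤-refl , Q[1+m] , λ 1+m<d′ d′≤1+m → contradiction d′≤1+m (<⇒≱ 1+m<d′)
  ... | no ¬Q[1+m] with greatest-≤ Q? Q0 m
  ... | d , d≤m , Qd , none-above = d , m≤n⇒m≤1+n d≤m , Qd , none-above′
    where
    none-above′ : ∀ {d′} → d < d′ → d′ ≤ suc m → ¬ Q d′
    none-above′ d<d′ d′≤1+m with m≤n⇒m<n∨m≡n d′≤1+m
    ... | inj₁ d′<1+m = none-above d<d′ (s≤s⁻¹ d′<1+m)
    ... | inj₂ refl   = ¬Q[1+m]

  BlockInvariant : ∀ {N} → Permutation′ N → ℕ → ℕ → Set
  BlockInvariant π a b = ∀ {j} → j < b → a ≤ ⌊ π ⌋ (a + j) × ⌊ π ⌋ (a + j) < a + b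

  module _ {N} (π : Permutation′ N) {a b} (a+b≤N : a + b ≤ N)
           (π-inv : BlockInvariant π a b) (π⁻¹-inv : BlockInvariant (flip π) a b) where

    private
      shifted : Permutation′ N → ℕ → ℕ
      shifted ρ j = ⌊ ρ ⌋ (a + j) ∸ a

      a+shifted : ∀ {ρ} → BlockInvariant ρ a b → ∀ {j} → j < b → a + shifted ρ j ≡ ⌊ ρ ⌋ (a + j)
      a+shifted ρ-inv j<b = m+[n∸m]≡n (proj₁ (ρ-inv j<b))

      shifted-< : ∀ {ρ} → BlockInvariant ρ a b → ∀ {j} → j < b → shifted ρ j < b
      shifted-< {ρ} ρ-inv {j} j<b =
        +-cancelˡ-< a _ _ (subst (_< a + b) (sym (a+shifted ρ-inv j<b)) (proj₂ (ρ-inv j<b)))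

      shifted-inverse : ∀ {ρ} → BlockInvariant ρ a b → ∀ {j} → j < b → shifted (flip ρ) (shifted ρ j) ≡ j
      shifted-inverse {ρ} ρ-inv {j} j<b = begin
        ⌊ flip ρ ⌋ (a + shifted ρ j) ∸ a  ≡⟨ cong (λ y → ⌊ flip ρ ⌋ y ∸ a) (a+shifted ρ-inv j<b) ⟩
        ⌊ flip ρ ⌋ (⌊ ρ ⌋ (a + j)) ∸ a    ≡⟨ cong (_∸ a) (⌊⌋-inverse ρ (<-≤-trans (+-monoʳ-< a j<b) a+b≤N)) ⟩
        a + j ∸ a                         ≡⟨ m+n∸m≡n a j ⟩
        j                                 ∎
        where open ≡-Reasoning

    block : Permutation′ b
    block = permFromℕ (shifted π) (shifted (flip π)) (shifted-< π-inv) (shifted-< π⁻¹-inv)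
                      (shifted-inverse π-inv) (shifted-inverse π⁻¹-inv)

    ⌊block⌋ : ∀ {j} → j < b → a + ⌊ block ⌋ j ≡ ⌊ π ⌋ (a + j)
    ⌊block⌋ j<b = trans (cong (a +_) (⌊permFromℕ⌋ _ _ _ _ _ _ j<b)) (a+shifted π-inv j<b)

  Fin+-elim : ∀ {a b} (P : Fin (a + b) → Set) → (∀ u → P (u ↑ˡ b)) → (∀ v → P (a ↑ʳ v)) → ∀ y → P y
  Fin+-elim {a} {b} P left right y = subst P (Finₚ.join-splitAt a b y) (elim (splitAt a y))
    where
    elim : ∀ s → P (join a b s)
    elim (inj₁ u) = left u
    elim (inj₂ v) = right v

  module _ {a b} (σ : Permutation′ a) (τ : Permutation′ b) where

    directSum-↑ˡ : ∀ u → directSum σ τ (u ↑ˡ b) ≡ (σ ⟨$⟩ʳ u) ↑ˡ b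
    directSum-↑ˡ u rewrite Finₚ.splitAt-↑ˡ a u b = refl

    directSum-↑ʳ : ∀ v → directSum σ τ (a ↑ʳ v) ≡ a ↑ʳ (τ ⟨$⟩ʳ v)
    directSum-↑ʳ v rewrite Finₚ.splitAt-↑ʳ a b v = refl

    directSum-splitsAt : ∀ y → toℕ y < a ⇔ toℕ (directSum σ τ y) < a
    directSum-splitsAt = Fin+-elim _ lower upper
      where
      lower : ∀ u → toℕ (u ↑ˡ b) < a ⇔ toℕ (directSum σ τ (u ↑ˡ b)) < a
      lower u rewrite directSum-↑ˡ u | Finₚ.toℕ-↑ˡ u b | Finₚ.toℕ-↑ˡ (σ ⟨$⟩ʳ u) b = both (Finₚ.toℕ<n u) (Finₚ.toℕ<n _)

      upper : ∀ v → toℕ (a ↑ʳ v) < a ⇔ toℕ (directSum σ τ (a ↑ʳ v)) < a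
      upper v rewrite directSum-↑ʳ v | Finₚ.toℕ-↑ʳ a v | Finₚ.toℕ-↑ʳ a (τ ⟨$⟩ʳ v) = neither (m+n≮m a _) (m+n≮m a _)

  sumDecomposable⇒splitsAt : ∀ {N} (π : Permutation′ N) → SumDecomposable π → ∃ λ d → d < N × 0 < d × SplitsAt π d
  sumDecomposable⇒splitsAt π (a , b , refl , a≢0 , b≢0 , σ , τ , π≡σ⊕τ) =
    a , m<m+n a (>-nonZero⁻¹ b {{b≢0}}) , >-nonZero⁻¹ a {{a≢0}} , splits
    where
    splits : SplitsAt π a
    splits = splitting λ x → subst₂ (λ i j → i < a ⇔ j < a) (Finₚ.toℕ-cast _ x)
                      (sym (trans (cong toℕ (π≡σ⊕τ x)) (Finₚ.toℕ-cast _ _)))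
                      (directSum-splitsAt σ τ (cast _ x))

  module _ {N} {π : Permutation′ N} {d} (d≤N : d ≤ N) (s : SplitsAt π d) where

    private
      d+[N∸d]≡N : d + (N ∸ d) ≡ N
      d+[N∸d]≡N = m+[n∸m]≡n d≤N

      lower-invariant : ∀ {ρ} → SplitsAt ρ d → BlockInvariant ρ 0 d
      lower-invariant sρ j<d = z≤n , to (splitsAtℕ sρ (<-≤-trans j<d d≤N)) j<d

      upper-invariant : ∀ {ρ} → SplitsAt ρ d → BlockInvariant ρ d (N ∸ d)
      upper-invariant {ρ} sρ {j} j<N∸d =
        splitsAt-≥ sρ d+j<N (m≤m+n d j) , subst (⌊ ρ ⌋ (d + j) <_) (sym d+[N∸d]≡N) (⌊⌋-< ρ d+j<N)
        where
        d+j<N : d + j < N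
        d+j<N = subst (d + j <_) d+[N∸d]≡N (+-monoʳ-< d j<N∸d)

    lowerBlock : Permutation′ d
    lowerBlock = block π d≤N (lower-invariant s) (lower-invariant (splitsAt-flip s))

    upperBlock : Permutation′ (N ∸ d)
    upperBlock = block π (≤-reflexive d+[N∸d]≡N) (upper-invariant s) (upper-invariant (splitsAt-flip s))

    ⌊lowerBlock⌋ : ∀ {j} → j < d → ⌊ lowerBlock ⌋ j ≡ ⌊ π ⌋ j
    ⌊lowerBlock⌋ = ⌊block⌋ π d≤N (lower-invariant s) (lower-invariant (splitsAt-flip s))

    ⌊upperBlock⌋ : ∀ {j} → j < N ∸ d → d + ⌊ upperBlock ⌋ j ≡ ⌊ π ⌋ (d + j)
    ⌊upperBlock⌋ = ⌊block⌋ π (≤-reflexive d+[N∸d]≡N) (upper-invariant s) (upper-invariant (splitsAt-flip s))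

    toℕ-lowerBlock⊕upperBlock : ∀ y → toℕ (directSum lowerBlock upperBlock y) ≡ ⌊ π ⌋ (toℕ y)
    toℕ-lowerBlock⊕upperBlock = Fin+-elim _ onLower onUpper
      where
      open ≡-Reasoning

      onLower : ∀ u → toℕ (directSum lowerBlock upperBlock (u ↑ˡ (N ∸ d))) ≡ ⌊ π ⌋ (toℕ (u ↑ˡ (N ∸ d)))
      onLower u = begin
        toℕ (directSum lowerBlock upperBlock (u ↑ˡ _))  ≡⟨ cong toℕ (directSum-↑ˡ lowerBlock upperBlock u) ⟩
        toℕ ((lowerBlock ⟨$⟩ʳ u) ↑ˡ _)                  ≡⟨ Finₚ.toℕ-↑ˡ _ _ ⟩
        toℕ (lowerBlock ⟨$⟩ʳ u)                         ≡⟨ ⌊⌋-toℕ lowerBlock u ⟨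
        ⌊ lowerBlock ⌋ (toℕ u)                          ≡⟨ ⌊lowerBlock⌋ (Finₚ.toℕ<n u) ⟩
        ⌊ π ⌋ (toℕ u)                                   ≡⟨ cong ⌊ π ⌋ (Finₚ.toℕ-↑ˡ u _) ⟨
        ⌊ π ⌋ (toℕ (u ↑ˡ _))                            ∎

      onUpper : ∀ v → toℕ (directSum lowerBlock upperBlock (d ↑ʳ v)) ≡ ⌊ π ⌋ (toℕ (d ↑ʳ v))
      onUpper v = begin
        toℕ (directSum lowerBlock upperBlock (d ↑ʳ v))  ≡⟨ cong toℕ (directSum-↑ʳ lowerBlock upperBlock v) ⟩
        toℕ (d ↑ʳ (upperBlock ⟨$⟩ʳ v))                  ≡⟨ Finₚ.toℕ-↑ʳ d _ ⟩
        d + toℕ (upperBlock ⟨$⟩ʳ v)                     ≡⟨ cong (d +_) (⌊⌋-toℕ upperBlock v) ⟨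
        d + ⌊ upperBlock ⌋ (toℕ v)                      ≡⟨ ⌊upperBlock⌋ (Finₚ.toℕ<n v) ⟩
        ⌊ π ⌋ (d + toℕ v)                               ≡⟨ cong ⌊ π ⌋ (Finₚ.toℕ-↑ʳ d v) ⟨
        ⌊ π ⌋ (toℕ (d ↑ʳ v))                            ∎

  splitsAt⇒sumDecomposable : ∀ {N} {π : Permutation′ N} {d} → d < N → 0 < d → SplitsAt π d → SumDecomposable π
  splitsAt⇒sumDecomposable {N} {π} {d} d<N 0<d s =
    d , N ∸ d , d+[N∸d]≡N , >-nonZero 0<d , >-nonZero (m<n⇒0<n∸m d<N) , lowerBlock d≤N s , upperBlock d≤N s , π≡blocks
    where
    open ≡-Reasoning

    d≤N : d ≤ N
    d≤N = <⇒≤ d<N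

    d+[N∸d]≡N : d + (N ∸ d) ≡ N
    d+[N∸d]≡N = m+[n∸m]≡n d≤N

    π≡blocks : ∀ x → π ⟨$⟩ʳ x ≡ cast d+[N∸d]≡N (directSum (lowerBlock d≤N s) (upperBlock d≤N s) (cast (sym d+[N∸d]≡N) x))
    π≡blocks x = Finₚ.toℕ-injective (begin
      toℕ (π ⟨$⟩ʳ x)                  ≡⟨ ⌊⌋-toℕ π x ⟨
      ⌊ π ⌋ (toℕ x)                   ≡⟨ cong ⌊ π ⌋ (Finₚ.toℕ-cast (sym d+[N∸d]≡N) x) ⟨
      ⌊ π ⌋ (toℕ y)                   ≡⟨ toℕ-lowerBlock⊕upperBlock d≤N s y ⟨
      toℕ (blocks y)                  ≡⟨ Finₚ.toℕ-cast d+[N∸d]≡N (blocks y) ⟨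
      toℕ (cast d+[N∸d]≡N (blocks y)) ∎)
      where
      y : Fin (d + (N ∸ d))
      y = cast (sym d+[N∸d]≡N) x

      blocks : Fin (d + (N ∸ d)) → Fin (d + (N ∸ d))
      blocks = directSum (lowerBlock d≤N s) (upperBlock d≤N s)

  sumDecomposable⇔splitsAt : ∀ {N} (π : Permutation′ N) → SumDecomposable π ⇔ (∃ λ d → d < N × 0 < d × SplitsAt π d)
  sumDecomposable⇔splitsAt π =
    mk⇔ (sumDecomposable⇒splitsAt π) (λ (_ , d<N , 0<d , s) → splitsAt⇒sumDecomposable d<N 0<d s)

  sumDecomposable? : ∀ {N} (π : Permutation′ N) → Dec (SumDecomposable π)
  sumDecomposable? {N} π = Dec.map (⇔.sym (sumDecomposable⇔splitsAt π)) (anyUpTo? (λ d → 0 <? d ×-dec splitsAt? π d) N)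

  -- j ↦ (j + a) mod (a + b) on [0, a + b)
  cycleℕ : ℕ → ℕ → ℕ → ℕ
  cycleℕ a b j with j <? b
  ... | yes _ = a + j
  ... | no _  = j ∸ b

  cycleℕ-< : ∀ a {b j} → j < b → cycleℕ a b j ≡ a + j
  cycleℕ-< a {b} {j} j<b with j <? b
  ... | yes _   = refl
  ... | no j≮b = contradiction j<b j≮b

  cycleℕ-≥ : ∀ a {b j} → b ≤ j → cycleℕ a b j ≡ j ∸ b
  cycleℕ-≥ a {b} {j} b≤j with j <? b
  ... | yes j<b = contradiction b≤j (<⇒≱ j<b)
  ... | no _    = refl

  private
    ∸-< : ∀ {a b j} → b ≤ j → j < a + b → j ∸ b < a
    ∸-< {a} {b} {j} b≤j j<a+b = +-cancelʳ-< b (j ∸ b) a (subst (_< a + b) (sym (m∸n+n≡m b≤j)) j<a+b)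

  cycleℕ-bound : ∀ a b {j} → j < a + b → cycleℕ a b j < a + b
  cycleℕ-bound a b {j} j<a+b with j <? b
  ... | yes j<b = +-monoʳ-< a j<b
  ... | no j≮b  = <-≤-trans (∸-< (≮⇒≥ j≮b) j<a+b) (m≤m+n a b)

  cycleℕ-inverse : ∀ a b {j} → j < a + b → cycleℕ b a (cycleℕ a b j) ≡ j
  cycleℕ-inverse a b {j} j<a+b with j <? b
  ... | yes _   = trans (cycleℕ-≥ b (m≤m+n a j)) (m+n∸m≡n a j)
  ... | no j≮b  = trans (cycleℕ-< b (∸-< (≮⇒≥ j≮b) j<a+b)) (m+[n∸m]≡n (≮⇒≥ j≮b))

  -- σ is ⊕π read from position d: if π = α ⊕ β with |α| = d, then σ = β ⊕ α.
  record IsRotation {n} (σ π : Permutation′ n) (d : ℕ) : Set where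
    constructor rotation
    field
      upper : ∀ {i} → i < n ∸ d → d + ⌊ σ ⌋ i ≡ ⌊ π ⌋ (d + i)
      lower : ∀ {j} → j < d → d + ⌊ σ ⌋ (n ∸ d + j) ≡ ⌊ π ⌋ j + n

  module _ {n d : ℕ} (d≤n : d ≤ n) where

    private
      e : ℕ
      e = n ∸ d

      d+e≡n : d + e ≡ n
      d+e≡n = m+[n∸m]≡n d≤n

      e+d≡n : e + d ≡ n
      e+d≡n = trans (+-comm e d) d+e≡n

      below-d+e : ∀ {j} → j < n → j < d + e
      below-d+e {j} = subst (j <_) (sym d+e≡n)

      below-e+d : ∀ {j} → j < n → j < e + d
      below-e+d {j} = subst (j <_) (sym e+d≡n)

      forward-< : ∀ {j} → j < n → cycleℕ d e j < n
      forward-< {j} j<n = subst (cycleℕ d e j <_) d+e≡n (cycleℕ-bound d e (below-d+e j<n))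

      backward-< : ∀ {j} → j < n → cycleℕ e d j < n
      backward-< {j} j<n = subst (cycleℕ e d j <_) e+d≡n (cycleℕ-bound e d (below-e+d j<n))

    cycle : Permutation′ n
    cycle = permFromℕ (cycleℕ d e) (cycleℕ e d) forward-< backward-<
              (λ j<n → cycleℕ-inverse d e (below-d+e j<n)) (λ j<n → cycleℕ-inverse e d (below-e+d j<n))

    rotate : Permutation′ n → Permutation′ n
    rotate π = cycle ∘ₚ π ∘ₚ flip cycle

    ⌊rotate⌋ : ∀ π {j} → j < n → ⌊ rotate π ⌋ j ≡ cycleℕ e d (⌊ π ⌋ (cycleℕ d e j))
    ⌊rotate⌋ π {j} j<n = begin
      ⌊ rotate π ⌋ j
        ≡⟨ ⌊∘ₚ⌋ cycle (π ∘ₚ flip cycle) j<n ⟩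
      ⌊ π ∘ₚ flip cycle ⌋ (⌊ cycle ⌋ j)
        ≡⟨ ⌊∘ₚ⌋ π (flip cycle) (⌊⌋-< cycle j<n) ⟩
      ⌊ flip cycle ⌋ (⌊ π ⌋ (⌊ cycle ⌋ j))
        ≡⟨ cong (λ y → ⌊ flip cycle ⌋ (⌊ π ⌋ y)) (⌊permFromℕ⌋ _ _ _ _ _ _ j<n) ⟩
      ⌊ flip cycle ⌋ (⌊ π ⌋ (cycleℕ d e j))
        ≡⟨ ⌊flip-permFromℕ⌋ _ _ _ _ _ _ (⌊⌋-< π (forward-< j<n)) ⟩
      cycleℕ e d (⌊ π ⌋ (cycleℕ d e j)) ∎
      where open ≡-Reasoning

    rotate-isRotation : ∀ {π} → SplitsAt π d → IsRotation (rotate π) π d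
    rotate-isRotation {π} s = rotation onUpper onLower
      where
      open ≡-Reasoning

      onUpper : ∀ {i} → i < e → d + ⌊ rotate π ⌋ i ≡ ⌊ π ⌋ (d + i)
      onUpper {i} i<e = begin
        d + ⌊ rotate π ⌋ i                     ≡⟨ cong (d +_) (⌊rotate⌋ π (<-≤-trans i<e (m∸n≤m n d))) ⟩
        d + cycleℕ e d (⌊ π ⌋ (cycleℕ d e i))  ≡⟨ cong (λ y → d + cycleℕ e d (⌊ π ⌋ y)) (cycleℕ-< d i<e) ⟩
        d + cycleℕ e d (⌊ π ⌋ (d + i))         ≡⟨ cong (d +_) (cycleℕ-≥ e d≤πj) ⟩
        d + (⌊ π ⌋ (d + i) ∸ d)                ≡⟨ m+[n∸m]≡n d≤πj ⟩
        ⌊ π ⌋ (d + i)                          ∎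
        where
        d≤πj : d ≤ ⌊ π ⌋ (d + i)
        d≤πj = splitsAt-≥ s (subst (d + i <_) d+e≡n (+-monoʳ-< d i<e)) (m≤m+n d i)

      onLower : ∀ {j} → j < d → d + ⌊ rotate π ⌋ (e + j) ≡ ⌊ π ⌋ j + n
      onLower {j} j<d = begin
        d + ⌊ rotate π ⌋ (e + j)
          ≡⟨ cong (d +_) (⌊rotate⌋ π (subst (e + j <_) e+d≡n (+-monoʳ-< e j<d))) ⟩
        d + cycleℕ e d (⌊ π ⌋ (cycleℕ d e (e + j)))
          ≡⟨ cong (λ y → d + cycleℕ e d (⌊ π ⌋ y)) (trans (cycleℕ-≥ d (m≤m+n e j)) (m+n∸m≡n e j)) ⟩
        d + cycleℕ e d (⌊ π ⌋ j)
          ≡⟨ cong (d +_) (cycleℕ-< e (to (splitsAtℕ s (<-≤-trans j<d d≤n)) j<d)) ⟩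
        d + (e + ⌊ π ⌋ j)
          ≡⟨ +-assoc d e _ ⟨
        d + e + ⌊ π ⌋ j
          ≡⟨ cong (_+ ⌊ π ⌋ j) d+e≡n ⟩
        n + ⌊ π ⌋ j
          ≡⟨ +-comm n _ ⟩
        ⌊ π ⌋ j + n ∎

  isRotation⇒splitsAt : ∀ {n} {σ π : Permutation′ n} {d} → d ≤ n → IsRotation σ π d → SplitsAt π d
  isRotation⇒splitsAt {n} {σ} {π} {d} d≤n (rotation onUpper onLower) = splitsAt-fromℕ splitsAt-j
    where
    splitsAt-j : ∀ {j} → j < n → j < d ⇔ ⌊ π ⌋ j < d
    splitsAt-j {j} j<n with j <? d
    ... | yes j<d = both j<d (+-cancelʳ-< n _ _ (subst (_< d + n) (onLower j<d) (+-monoʳ-< d (⌊⌋-< σ n∸d+j<n))))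
      where
      n∸d+j<n : n ∸ d + j < n
      n∸d+j<n = subst (n ∸ d + j <_) (m∸n+n≡m d≤n) (+-monoʳ-< (n ∸ d) j<d)
    ... | no j≮d = neither j≮d (≤⇒≯ d≤πj)
      where
      d≤j : d ≤ j
      d≤j = ≮⇒≥ j≮d

      d≤πj : d ≤ ⌊ π ⌋ j
      d≤πj = subst (λ k → d ≤ ⌊ π ⌋ k) (m+[n∸m]≡n d≤j)
                   (subst (d ≤_) (onUpper (∸-monoˡ-< j<n d≤j)) (m≤m+n d _))

  isRotation-zero : ∀ {n} {σ π : Permutation′ n} → IsRotation σ π 0 → SamePerm σ π
  isRotation-zero {σ = σ} {π} (rotation onUpper _) x = Finₚ.toℕ-injective (begin
    toℕ (σ ⟨$⟩ʳ x)  ≡⟨ ⌊⌋-toℕ σ x ⟨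
    ⌊ σ ⌋ (toℕ x)   ≡⟨ onUpper (Finₚ.toℕ<n x) ⟩
    ⌊ π ⌋ (toℕ x)   ≡⟨ ⌊⌋-toℕ π x ⟩
    toℕ (π ⟨$⟩ʳ x)  ∎)
    where open ≡-Reasoning

  private
    +-<-⇔ : ∀ d {a b} → a < b ⇔ d + a < d + b
    +-<-⇔ d = mk⇔ (+-monoʳ-< d) (+-cancelˡ-< d _ _)

  isRotation-splitsAt-+ : ∀ {n} {σ π : Permutation′ n} {d e} → d + e ≤ n →
                          IsRotation σ π d → SplitsAt σ e → SplitsAt π (d + e)
  isRotation-splitsAt-+ {n} {σ} {π} {d} {e} d+e≤n rot@(rotation onUpper _) sσ = splitsAt-fromℕ splitsAt-j
    where
    d≤n : d ≤ n
    d≤n = ≤-trans (m≤m+n d e) d+e≤n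

    splitsAt-j : ∀ {j} → j < n → j < d + e ⇔ ⌊ π ⌋ j < d + e
    splitsAt-j {j} j<n with j <? d
    ... | yes j<d = both (<-≤-trans j<d (m≤m+n d e))
                         (<-≤-trans (to (splitsAtℕ (isRotation⇒splitsAt d≤n rot) j<n) j<d) (m≤m+n d e))
    ... | no j≮d = subst (λ k → k < d + e ⇔ ⌊ π ⌋ k < d + e) (m+[n∸m]≡n (≮⇒≥ j≮d)) shifted
      where
      i<n∸d : j ∸ d < n ∸ d
      i<n∸d = ∸-monoˡ-< j<n (≮⇒≥ j≮d)

      shifted : d + (j ∸ d) < d + e ⇔ ⌊ π ⌋ (d + (j ∸ d)) < d + e
      shifted = ⇔.trans (⇔.sym (+-<-⇔ d))
                (⇔.trans (splitsAtℕ sσ (<-≤-trans i<n∸d (m∸n≤m n d)))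
                         (subst (λ k → ⌊ σ ⌋ (j ∸ d) < e ⇔ k < d + e) (onUpper i<n∸d) (+-<-⇔ d)))

  toℕ-punchIn-< : ∀ {N} (p : Fin (suc N)) (x : Fin N) → toℕ x < toℕ p → toℕ (punchIn p x) ≡ toℕ x
  toℕ-punchIn-< (Fin.suc p) Fin.zero    _         = refl
  toℕ-punchIn-< (Fin.suc p) (Fin.suc x) (s≤s x<p) = cong suc (toℕ-punchIn-< p x x<p)

  toℕ-punchIn-≥ : ∀ {N} (p : Fin (suc N)) (x : Fin N) → toℕ p ≤ toℕ x → toℕ (punchIn p x) ≡ suc (toℕ x)
  toℕ-punchIn-≥ Fin.zero    x           _         = refl
  toℕ-punchIn-≥ (Fin.suc p) (Fin.suc x) (s≤s p≤x) = cong suc (toℕ-punchIn-≥ p x p≤x)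

  punchIn-<-⇔ : ∀ {N e} (p : Fin (suc N)) (x : Fin N) → e ≤ toℕ p → toℕ x < e ⇔ toℕ (punchIn p x) < e
  punchIn-<-⇔ {e = e} p x e≤p with toℕ x <? toℕ p
  ... | yes x<p = subst (λ k → toℕ x < e ⇔ k < e) (sym (toℕ-punchIn-< p x x<p)) ⇔.refl
  ... | no x≮p  = subst (λ k → toℕ x < e ⇔ k < e) (sym (toℕ-punchIn-≥ p x p≤x))
                        (neither (≤⇒≯ e≤x) (≤⇒≯ (m≤n⇒m≤1+n e≤x)))
    where
    p≤x : toℕ p ≤ toℕ x
    p≤x = ≮⇒≥ x≮p

    e≤x : e ≤ toℕ x
    e≤x = ≤-trans e≤p p≤x

  insert-cong : ∀ {N} i j (π ρ : Permutation′ N) → SamePerm π ρ → SamePerm (insert i j π) (insert i j ρ)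
  insert-cong i j π ρ π≈ρ k with i Fin.≟ k
  ... | yes _ = refl
  ... | no _  = cong (punchIn j) (π≈ρ _)

  insert-at : ∀ {N} i j (π : Permutation′ N) → insert i j π ⟨$⟩ʳ i ≡ j
  insert-at i j π with i Fin.≟ i
  ... | yes _  = refl
  ... | no i≢i = contradiction refl i≢i

  remove-cong : ∀ {N} p (τ τ′ : Permutation′ (suc N)) → SamePerm τ τ′ → SamePerm (remove p τ) (remove p τ′)
  remove-cong p τ τ′ τ≈τ′ x = Finₚ.punchIn-injective (τ ⟨$⟩ʳ p) _ _ (begin
    punchIn (τ ⟨$⟩ʳ p) (remove p τ ⟨$⟩ʳ x)    ≡⟨ punchIn-permute τ p x ⟨
    τ ⟨$⟩ʳ punchIn p x                         ≡⟨ τ≈τ′ _ ⟩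
    τ′ ⟨$⟩ʳ punchIn p x                        ≡⟨ punchIn-permute τ′ p x ⟩
    punchIn (τ′ ⟨$⟩ʳ p) (remove p τ′ ⟨$⟩ʳ x)  ≡⟨ cong (λ q → punchIn q _) (τ≈τ′ p) ⟨
    punchIn (τ ⟨$⟩ʳ p) (remove p τ′ ⟨$⟩ʳ x)   ∎)
    where open ≡-Reasoning

  remove-injective : ∀ {N} p (τ τ′ : Permutation′ (suc N)) → τ ⟨$⟩ʳ p ≡ τ′ ⟨$⟩ʳ p →
                     SamePerm (remove p τ) (remove p τ′) → SamePerm τ τ′
  remove-injective p τ τ′ τp≡τ′p rem≈rem′ x = begin
    τ ⟨$⟩ʳ x                                       ≡⟨ insert-remove p τ x ⟨
    insert p (τ ⟨$⟩ʳ p) (remove p τ) ⟨$⟩ʳ x        ≡⟨ cong (λ q → insert p q (remove p τ) ⟨$⟩ʳ x) τp≡τ′p ⟩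
    insert p (τ′ ⟨$⟩ʳ p) (remove p τ) ⟨$⟩ʳ x       ≡⟨ insert-cong p _ (remove p τ) (remove p τ′) rem≈rem′ x ⟩
    insert p (τ′ ⟨$⟩ʳ p) (remove p τ′) ⟨$⟩ʳ x      ≡⟨ insert-remove p τ′ x ⟩
    τ′ ⟨$⟩ʳ x                                      ∎
    where open ≡-Reasoning

  module _ {N} (τ : Permutation′ (suc N)) (p : Fin (suc N)) (τp≡max : τ ⟨$⟩ʳ p ≡ Fin.fromℕ N) where

    toℕ-remove : ∀ x → toℕ (remove p τ ⟨$⟩ʳ x) ≡ toℕ (τ ⟨$⟩ʳ punchIn p x)
    toℕ-remove x = begin
      toℕ (remove p τ ⟨$⟩ʳ x)                           ≡⟨ toℕ-punchIn-< (Fin.fromℕ N) (remove p τ ⟨$⟩ʳ x) below-max ⟨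
      toℕ (punchIn (Fin.fromℕ N) (remove p τ ⟨$⟩ʳ x))   ≡⟨ cong (λ q → toℕ (punchIn q (remove p τ ⟨$⟩ʳ x))) τp≡max ⟨
      toℕ (punchIn (τ ⟨$⟩ʳ p) (remove p τ ⟨$⟩ʳ x))      ≡⟨ cong toℕ (punchIn-permute τ p x) ⟨
      toℕ (τ ⟨$⟩ʳ punchIn p x)                          ∎
      where
      open ≡-Reasoning
      below-max : toℕ (remove p τ ⟨$⟩ʳ x) < toℕ (Fin.fromℕ N)
      below-max = subst (toℕ (remove p τ ⟨$⟩ʳ x) <_) (sym (Finₚ.toℕ-fromℕ N)) (Finₚ.toℕ<n _)

    splitsAt-remove : ∀ {e} → e ≤ toℕ p → SplitsAt τ e ⇔ SplitsAt (remove p τ) e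
    splitsAt-remove {e} e≤p = mk⇔ restrict extend
      where
      along : ∀ x → toℕ (punchIn p x) < e ⇔ toℕ (τ ⟨$⟩ʳ punchIn p x) < e →
              toℕ x < e ⇔ toℕ (remove p τ ⟨$⟩ʳ x) < e
      along x punchIn-splits = ⇔.trans (punchIn-<-⇔ p x e≤p)
                                  (subst (λ k → toℕ (punchIn p x) < e ⇔ k < e) (sym (toℕ-remove x)) punchIn-splits)

      restrict : SplitsAt τ e → SplitsAt (remove p τ) e
      restrict s = splitting λ x → along x (below-⇔ s (punchIn p x))

      extend-at : SplitsAt (remove p τ) e → ∀ y → toℕ y < e ⇔ toℕ (τ ⟨$⟩ʳ y) < e
      extend-at s y with p Fin.≟ y
      ... | yes refl = neither (≤⇒≯ e≤p) (≤⇒≯ (≤-trans e≤p (subst (toℕ p ≤_) max-value (Finₚ.toℕ≤pred[n] p))))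
        where
        max-value : N ≡ toℕ (τ ⟨$⟩ʳ p)
        max-value = sym (trans (cong toℕ τp≡max) (Finₚ.toℕ-fromℕ N))
      ... | no p≢y = subst (λ z → toℕ z < e ⇔ toℕ (τ ⟨$⟩ʳ z) < e) (Finₚ.punchIn-punchOut p≢y)
                       (⇔.trans (⇔.sym (punchIn-<-⇔ p x e≤p))
                                (subst (λ k → toℕ x < e ⇔ k < e) (toℕ-remove x) (below-⇔ s x)))
        where
        x : Fin N
        x = punchOut p≢y

      extend : SplitsAt (remove p τ) e → SplitsAt τ e
      extend s = splitting (extend-at s)

  samePerm-isDecEquivalence : ∀ {N} → IsDecEquivalence (SamePerm {N})
  samePerm-isDecEquivalence = record
    { isEquivalence = record
      { refl  = λ _ → refl
      ; sym   = λ π≈ρ i → sym (π≈ρ i)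
      ; trans = λ π≈ρ ρ≈σ i → trans (π≈ρ i) (ρ≈σ i)
      }
    ; _≟_ = λ π ρ → Finₚ.all? (λ i → π ⟨$⟩ʳ i Fin.≟ ρ ⟨$⟩ʳ i)
    }

  permutations : ∀ N → List (Permutation′ N)
  permutations zero    = Perm.id ∷ []
  permutations (suc N) = cartesianProductWith (insert Fin.zero) (allFin (suc N)) (permutations N)

  permutations-complete : ∀ {N} (π : Permutation′ N) → ∃ λ ρ → ρ ∈ permutations N × SamePerm ρ π
  permutations-complete {zero}  π = Perm.id , here refl , λ ()
  permutations-complete {suc N} π with permutations-complete (remove Fin.zero π)
  ... | ρ , ρ∈ , ρ≈π₀ = insert Fin.zero (π ⟨$⟩ʳ Fin.zero) ρ
                      , ∈-cartesianProductWith⁺ (insert Fin.zero) (∈-allFin _) ρ∈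
                      , λ x → trans (insert-cong Fin.zero _ ρ (remove Fin.zero π) ρ≈π₀ x) (insert-remove Fin.zero π x)

  sumIndecomposable-resp : ∀ {N} (π ρ : Permutation′ N) → SamePerm π ρ → SumIndecomposable π → SumIndecomposable ρ
  sumIndecomposable-resp π ρ π≈ρ indec (a , b , e , a≢0 , b≢0 , σ , τ , ρ≡σ⊕τ) =
    indec (a , b , e , a≢0 , b≢0 , σ , τ , λ x → trans (π≈ρ x) (ρ≡σ⊕τ x))

  removeMax-splitsAt⇒sumDecomposable : ∀ {N} (τ : Permutation′ (suc N)) p → τ ⟨$⟩ʳ p ≡ Fin.fromℕ N →
                                       ∀ {d} → 0 < d → d ≤ toℕ p → SplitsAt (remove p τ) d → SumDecomposable τ
  removeMax-splitsAt⇒sumDecomposable τ p τp≡max 0<d d≤p s =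
    splitsAt⇒sumDecomposable (s≤s (≤-trans d≤p (Finₚ.toℕ≤pred[n] p))) 0<d (from (splitsAt-remove τ p τp≡max d≤p) s)

  insertMax-indecomposable : ∀ {N} (σ : Permutation′ N) pos → (∀ {e} → 0 < e → e ≤ toℕ pos → ¬ SplitsAt σ e) →
                             SumIndecomposable (insert pos (Fin.fromℕ N) σ)
  insertMax-indecomposable {N} σ pos no-split decomposable
    with sumDecomposable⇒splitsAt (insert pos (Fin.fromℕ N) σ) decomposable
  ... | e , e<1+N , 0<e , splits with e ≤? toℕ pos
  ... | yes e≤pos = no-split 0<e e≤pos (splitsAt-cong (remove-insert pos _ σ)
                      (to (splitsAt-remove _ pos (insert-at pos _ σ) e≤pos) splits))
  ... | no e≰pos  = contradiction (to (below-⇔ splits pos) (≰⇒> e≰pos)) (≤⇒≯ (subst (e ≤_) (sym toℕ-max) (s≤s⁻¹ e<1+N)))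
    where
    toℕ-max : toℕ (insert pos (Fin.fromℕ N) σ ⟨$⟩ʳ pos) ≡ N
    toℕ-max = trans (cong toℕ (insert-at pos _ σ)) (Finₚ.toℕ-fromℕ N)

open Permutations

module AffinePermutations (n : ℕ) .{{_ : NonZero n}} where
  open import Data.Nat as ℕ using (zero; _<_; _≤_; _<?_)
  import Data.Nat.Properties as ℕₚ
  open import Data.Integer using (ℤ; +_; -[1+_]; -_; _+_; _-_; _*_; 0ℤ; 1ℤ)
  open import Data.Integer.Properties using (+-injective; pos-*; +-identityˡ)
  open import Data.Integer.DivMod using (_%ℕ_; _/ℕ_; n%ℕd<d; a≡a%ℕn+[a/ℕn]*n)
  open import Data.Integer.Tactic.RingSolver using (solve-∀)
  open ≡-Reasoning

  private
    n≤j+[1+m]*n : ∀ j m → n ≤ j ℕ.+ suc m ℕ.* n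
    n≤j+[1+m]*n j m = ℕₚ.≤-trans (ℕₚ.m≤m+n n (m ℕ.* n)) (ℕₚ.m≤n+m (suc m ℕ.* n) j)

    j+[1+m]*n≡ : ∀ {j j′} m → + j + + suc m * + n ≡ + j′ → j ℕ.+ suc m ℕ.* n ≡ j′
    j+[1+m]*n≡ {j} m eq = +-injective (trans (cong (_+_ (+ j)) (pos-* (suc m) n)) eq)

    move-right : ∀ (J M N : ℤ) → J ≡ J + (- M) * N + M * N
    move-right = solve-∀

  quotient-zero : ∀ {j j′} t → j < n → j′ < n → + j + t * + n ≡ + j′ → t ≡ 0ℤ
  quotient-zero (+ zero)  _   _    _  = refl
  quotient-zero {j} {j′} (+ suc m) _ j′<n eq =
    contradiction j′<n (ℕₚ.≤⇒≯ (subst (n ≤_) (j+[1+m]*n≡ m eq) (n≤j+[1+m]*n j m)))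
  quotient-zero {j} {j′} -[1+ m ] j<n _ eq =
    contradiction j<n (ℕₚ.≤⇒≯ (subst (n ≤_) (j+[1+m]*n≡ m (sym j≡j′+[1+m]*n)) (n≤j+[1+m]*n j′ m)))
    where
    j≡j′+[1+m]*n : + j ≡ + j′ + + suc m * + n
    j≡j′+[1+m]*n = trans (move-right (+ j) (+ suc m) (+ n)) (cong (_+ + suc m * + n) eq)

  window-unique : ∀ {j j′ k k′} → j < n → j′ < n → + j + k * + n ≡ + j′ + k′ * + n → j ≡ j′ × k ≡ k′
  window-unique {j} {j′} {k} {k′} j<n j′<n eq = +-injective j≡j′ , k≡k′
    where
    difference : ∀ (J K K′ N : ℤ) → J + (K - K′) * N ≡ J + K * N - K′ * N
    difference = solve-∀

    cancel : ∀ (J K N : ℤ) → J + K * N - K * N ≡ J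
    cancel = solve-∀

    add-back : ∀ (K K′ : ℤ) → K ≡ K - K′ + K′
    add-back = solve-∀

    k≡k′ : k ≡ k′
    k≡k′ = begin
      k             ≡⟨ add-back k k′ ⟩
      k - k′ + k′   ≡⟨ cong (_+ k′) (quotient-zero (k - k′) j<n j′<n (begin
                         + j + (k - k′) * + n       ≡⟨ difference (+ j) k k′ (+ n) ⟩
                         + j + k * + n - k′ * + n   ≡⟨ cong (_- k′ * + n) eq ⟩
                         + j′ + k′ * + n - k′ * + n ≡⟨ cancel (+ j′) k′ (+ n) ⟩
                         + j′                       ∎)) ⟩
      0ℤ + k′       ≡⟨ +-identityˡ k′ ⟩
      k′            ∎

    j≡j′ : + j ≡ + j′
    j≡j′ = begin
      + j                        ≡⟨ cancel (+ j) k (+ n) ⟨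
      + j + k * + n - k * + n    ≡⟨ cong₂ (λ a b → a - b * + n) eq k≡k′ ⟩
      + j′ + k′ * + n - k′ * + n ≡⟨ cancel (+ j′) k′ (+ n) ⟩
      + j′                       ∎

  divmod-window : ∀ {j} k → j < n → (+ j + k * + n) %ℕ n ≡ j × (+ j + k * + n) /ℕ n ≡ k
  divmod-window {j} k j<n = window-unique (n%ℕd<d a n) j<n (sym (a≡a%ℕn+[a/ℕn]*n a n))
    where
    a : ℤ
    a = + j + k * + n

  infSum-window : ∀ π {j} k → j < n → infSum n π (+ suc j + k * + n) ≡ + suc (⌊ π ⌋ j) + k * + n
  infSum-window π {j} k j<n = begin
    infSum n π (+ suc j + k * + n)                       ≡⟨ cong value (drop-one (+ j) (k * + n)) ⟩
    value (+ j + k * + n)                                ≡⟨ cong₂ (λ x q → + suc (toℕ (π ⟨$⟩ʳ x)) + q * + n)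
                                                             (Finₚ.fromℕ<-cong _ _ (proj₁ (divmod-window k j<n)) _ j<n)
                                                             (proj₂ (divmod-window k j<n)) ⟩
    + suc (toℕ (π ⟨$⟩ʳ fromℕ< j<n)) + k * + n           ≡⟨ cong (λ y → + suc y + k * + n) (⌊⌋-fromℕ< π j<n) ⟨
    + suc (⌊ π ⌋ j) + k * + n                            ∎
    where
    value : ℤ → ℤ
    value a = + suc (toℕ (π ⟨$⟩ʳ fromℕ< (n%ℕd<d a n))) + (a /ℕ n) * + n

    drop-one : ∀ (J K : ℤ) → + 1 + J + K - + 1 ≡ J + K
    drop-one = solve-∀

  affineOf-window : ∀ π r {j} k → j < n → affineOf n (π , r) (r + + suc j + k * + n) ≡ r + + suc (⌊ π ⌋ j) + k * + n
  affineOf-window π r {j} k j<n = begin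
    infSum n π (r + + suc j + k * + n - r) + r      ≡⟨ cong (λ z → infSum n π z + r) (unshift r (+ suc j) (k * + n)) ⟩
    infSum n π (+ suc j + k * + n) + r              ≡⟨ cong (_+ r) (infSum-window π k j<n) ⟩
    + suc (⌊ π ⌋ j) + k * + n + r                   ≡⟨ reshift r (+ suc (⌊ π ⌋ j)) (k * + n) ⟩
    r + + suc (⌊ π ⌋ j) + k * + n                   ∎
    where
    unshift : ∀ (R X Q : ℤ) → R + X + Q - R ≡ X + Q
    unshift = solve-∀

    reshift : ∀ (R X Q : ℤ) → X + Q + R ≡ R + X + Q
    reshift = solve-∀

  window-cover : ∀ r z → ∃₂ λ j k → j < n × z ≡ r + + suc j + k * + n
  window-cover r z = a %ℕ n , a /ℕ n , n%ℕd<d a n , (begin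
    z                                        ≡⟨ split z r ⟩
    r + + 1 + a                              ≡⟨ cong (_+_ (r + + 1)) (a≡a%ℕn+[a/ℕn]*n a n) ⟩
    r + + 1 + (+ (a %ℕ n) + a /ℕ n * + n)    ≡⟨ regroup r (+ (a %ℕ n)) (a /ℕ n * + n) ⟩
    r + + suc (a %ℕ n) + a /ℕ n * + n        ∎)
    where
    a : ℤ
    a = z - r - + 1

    split : ∀ (Z R : ℤ) → Z ≡ R + + 1 + (Z - R - + 1)
    split = solve-∀

    regroup : ∀ (R J Q : ℤ) → R + + 1 + (J + Q) ≡ R + (+ 1 + J) + Q
    regroup = solve-∀

  sameAffine-byWindows : ∀ {p q} r →
                         (∀ {j} k → j < n → affineOf n p (r + + suc j + k * + n) ≡ affineOf n q (r + + suc j + k * + n)) →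
                         SameAffine n p q
  sameAffine-byWindows {p} {q} r agree z with window-cover r z
  ... | j , k , j<n , refl = agree k j<n

  window-injective : ∀ r k {a b} → r + + suc a + k * + n ≡ r + + suc b + k * + n → a ≡ b
  window-injective r k {a} {b} eq = ℕₚ.suc-injective (+-injective (begin
    + suc a                          ≡⟨ isolate r (+ suc a) (k * + n) ⟩
    r + + suc a + k * + n - r - k * + n  ≡⟨ cong (λ w → w - r - k * + n) eq ⟩
    r + + suc b + k * + n - r - k * + n  ≡⟨ isolate r (+ suc b) (k * + n) ⟨
    + suc b                          ∎))
    where
    isolate : ∀ (R X Q : ℤ) → X ≡ R + X + Q - R - Q
    isolate = solve-∀

  -- + suc x computes to + 1 + + x and + (d ℕ.+ i) to + d + + i, so such window identities are
  -- instances of ring identities.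
  window-shift : ∀ r d i k → r + + d + + suc i + k * + n ≡ r + + suc (d ℕ.+ i) + k * + n
  window-shift r d i k = solve r (+ d) (+ i) (k * + n)
    where
    solve : ∀ (R D I Q : ℤ) → R + D + (+ 1 + I) + Q ≡ R + (+ 1 + D + I) + Q
    solve = solve-∀

  window-wrap : ∀ r x k → r + + suc (n ℕ.+ x) + (k - 1ℤ) * + n ≡ r + + suc x + k * + n
  window-wrap r x k = solve r (+ n) (+ x) k
    where
    solve : ∀ (R N X K : ℤ) → R + (+ 1 + N + X) + (K - + 1) * N ≡ R + (+ 1 + X) + K * N
    solve = solve-∀

  window-wrap-shift : ∀ r d {y x} k → d ℕ.+ y ≡ n ℕ.+ x → r + + d + + suc y + (k - 1ℤ) * + n ≡ r + + suc x + k * + n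
  window-wrap-shift r d {y} {x} k d+y≡n+x = begin
    r + + d + + suc y + (k - 1ℤ) * + n      ≡⟨ window-shift r d y (k - 1ℤ) ⟩
    r + + suc (d ℕ.+ y) + (k - 1ℤ) * + n    ≡⟨ cong (λ m → r + + suc m + (k - 1ℤ) * + n) d+y≡n+x ⟩
    r + + suc (n ℕ.+ x) + (k - 1ℤ) * + n    ≡⟨ window-wrap r x k ⟩
    r + + suc x + k * + n                   ∎

  sameAffine-cong : ∀ σ π r → SamePerm σ π → SameAffine n (σ , r) (π , r)
  sameAffine-cong σ π r σ≈π = sameAffine-byWindows {σ , r} {π , r} r λ {j} k j<n → begin
    affineOf n (σ , r) (r + + suc j + k * + n)  ≡⟨ affineOf-window σ r k j<n ⟩
    r + + suc (⌊ σ ⌋ j) + k * + n               ≡⟨ cong (λ y → r + + suc y + k * + n) (⌊⌋-cong σ≈π j<n) ⟩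
    r + + suc (⌊ π ⌋ j) + k * + n               ≡⟨ affineOf-window π r k j<n ⟨
    affineOf n (π , r) (r + + suc j + k * + n)  ∎

  sameAffine-period : ∀ π r k → SameAffine n (π , r + k * + n) (π , r)
  sameAffine-period π r k = sameAffine-byWindows {π , r + k * + n} {π , r} r λ {j} k′ j<n → begin
    affineOf n (π , r + k * + n) (r + + suc j + k′ * + n)
      ≡⟨ cong (affineOf n (π , r + k * + n)) (reframe r (+ suc j) k k′ (+ n)) ⟩
    affineOf n (π , r + k * + n) (r + k * + n + + suc j + (k′ - k) * + n)
      ≡⟨ affineOf-window π (r + k * + n) (k′ - k) j<n ⟩
    r + k * + n + + suc (⌊ π ⌋ j) + (k′ - k) * + n
      ≡⟨ reframe r (+ suc (⌊ π ⌋ j)) k k′ (+ n) ⟨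
    r + + suc (⌊ π ⌋ j) + k′ * + n
      ≡⟨ affineOf-window π r k′ j<n ⟨
    affineOf n (π , r) (r + + suc j + k′ * + n) ∎
    where
    reframe : ∀ (R X K K′ N : ℤ) → R + X + K′ * N ≡ R + K * N + X + (K′ - K) * N
    reframe = solve-∀

  module _ (σ π : Permutation′ n) {d} (r : ℤ) (d≤n : d ℕ.≤ n) where

    private
      e : ℕ
      e = n ℕ.∸ d

      i<n : ∀ {i} → i < e → i < n
      i<n i<e = ℕₚ.<-≤-trans i<e (ℕₚ.m∸n≤m n d)

      d+i<n : ∀ {i} → i < e → d ℕ.+ i < n
      d+i<n {i} i<e = subst (d ℕ.+ i <_) (ℕₚ.m+[n∸m]≡n d≤n) (ℕₚ.+-monoʳ-< d i<e)

      e+j<n : ∀ {j} → j < d → e ℕ.+ j < n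
      e+j<n {j} j<d = subst (e ℕ.+ j <_) (ℕₚ.m∸n+n≡m d≤n) (ℕₚ.+-monoʳ-< e j<d)

      d+[e+j]≡n+j : ∀ j → d ℕ.+ (e ℕ.+ j) ≡ n ℕ.+ j
      d+[e+j]≡n+j j = trans (sym (ℕₚ.+-assoc d e j)) (cong (ℕ._+ j) (ℕₚ.m+[n∸m]≡n d≤n))

    isRotation⇒sameAffine : IsRotation σ π d → SameAffine n (σ , r + + d) (π , r)
    isRotation⇒sameAffine (rotation onUpper onLower) = sameAffine-byWindows {σ , r + + d} {π , r} r agree
      where
      agree : ∀ {j} k → j < n →
              affineOf n (σ , r + + d) (r + + suc j + k * + n) ≡ affineOf n (π , r) (r + + suc j + k * + n)
      agree {j} k j<n with j <? d
      ... | yes j<d = begin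
        affineOf n (σ , r + + d) (r + + suc j + k * + n)
          ≡⟨ cong (affineOf n (σ , r + + d)) (window-wrap-shift r d k (d+[e+j]≡n+j j)) ⟨
        affineOf n (σ , r + + d) (r + + d + + suc (e ℕ.+ j) + (k - 1ℤ) * + n)
          ≡⟨ affineOf-window σ (r + + d) (k - 1ℤ) (e+j<n j<d) ⟩
        r + + d + + suc (⌊ σ ⌋ (e ℕ.+ j)) + (k - 1ℤ) * + n
          ≡⟨ window-wrap-shift r d k (trans (onLower j<d) (ℕₚ.+-comm _ n)) ⟩
        r + + suc (⌊ π ⌋ j) + k * + n
          ≡⟨ affineOf-window π r k j<n ⟨
        affineOf n (π , r) (r + + suc j + k * + n) ∎
      ... | no j≮d = begin
        affineOf n (σ , r + + d) (r + + suc j + k * + n)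
          ≡⟨ cong (λ m → affineOf n (σ , r + + d) (r + + suc m + k * + n)) d+i≡j ⟨
        affineOf n (σ , r + + d) (r + + suc (d ℕ.+ i) + k * + n)
          ≡⟨ cong (affineOf n (σ , r + + d)) (window-shift r d i k) ⟨
        affineOf n (σ , r + + d) (r + + d + + suc i + k * + n)
          ≡⟨ affineOf-window σ (r + + d) k (i<n i<e) ⟩
        r + + d + + suc (⌊ σ ⌋ i) + k * + n
          ≡⟨ window-shift r d (⌊ σ ⌋ i) k ⟩
        r + + suc (d ℕ.+ ⌊ σ ⌋ i) + k * + n
          ≡⟨ cong (λ m → r + + suc m + k * + n) (onUpper i<e) ⟩
        r + + suc (⌊ π ⌋ (d ℕ.+ i)) + k * + n
          ≡⟨ cong (λ m → r + + suc (⌊ π ⌋ m) + k * + n) d+i≡j ⟩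
        r + + suc (⌊ π ⌋ j) + k * + n
          ≡⟨ affineOf-window π r k j<n ⟨
        affineOf n (π , r) (r + + suc j + k * + n) ∎
        where
        i : ℕ
        i = j ℕ.∸ d

        i<e : i < e
        i<e = ℕₚ.∸-monoˡ-< j<n (ℕₚ.≮⇒≥ j≮d)

        d+i≡j : d ℕ.+ i ≡ j
        d+i≡j = ℕₚ.m+[n∸m]≡n (ℕₚ.≮⇒≥ j≮d)

    sameAffine⇒isRotation : SameAffine n (σ , r + + d) (π , r) → IsRotation σ π d
    sameAffine⇒isRotation same = rotation onUpper onLower
      where
      onUpper : ∀ {i} → i < e → d ℕ.+ ⌊ σ ⌋ i ≡ ⌊ π ⌋ (d ℕ.+ i)
      onUpper {i} i<e = window-injective r 0ℤ (begin
        r + + suc (d ℕ.+ ⌊ σ ⌋ i) + 0ℤ * + n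
          ≡⟨ window-shift r d (⌊ σ ⌋ i) 0ℤ ⟨
        r + + d + + suc (⌊ σ ⌋ i) + 0ℤ * + n
          ≡⟨ affineOf-window σ (r + + d) 0ℤ (i<n i<e) ⟨
        affineOf n (σ , r + + d) (r + + d + + suc i + 0ℤ * + n)
          ≡⟨ cong (affineOf n (σ , r + + d)) (window-shift r d i 0ℤ) ⟩
        affineOf n (σ , r + + d) (r + + suc (d ℕ.+ i) + 0ℤ * + n)
          ≡⟨ same (r + + suc (d ℕ.+ i) + 0ℤ * + n) ⟩
        affineOf n (π , r) (r + + suc (d ℕ.+ i) + 0ℤ * + n)
          ≡⟨ affineOf-window π r 0ℤ (d+i<n i<e) ⟩
        r + + suc (⌊ π ⌋ (d ℕ.+ i)) + 0ℤ * + n ∎)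

      onLower : ∀ {j} → j < d → d ℕ.+ ⌊ σ ⌋ (e ℕ.+ j) ≡ ⌊ π ⌋ j ℕ.+ n
      onLower {j} j<d = trans (window-injective r (0ℤ - 1ℤ) (begin
        r + + suc (d ℕ.+ ⌊ σ ⌋ (e ℕ.+ j)) + (0ℤ - 1ℤ) * + n
          ≡⟨ window-shift r d _ (0ℤ - 1ℤ) ⟨
        r + + d + + suc (⌊ σ ⌋ (e ℕ.+ j)) + (0ℤ - 1ℤ) * + n
          ≡⟨ affineOf-window σ (r + + d) (0ℤ - 1ℤ) (e+j<n j<d) ⟨
        affineOf n (σ , r + + d) (r + + d + + suc (e ℕ.+ j) + (0ℤ - 1ℤ) * + n)
          ≡⟨ cong (affineOf n (σ , r + + d)) (window-wrap-shift r d 0ℤ (d+[e+j]≡n+j j)) ⟩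
        affineOf n (σ , r + + d) (r + + suc j + 0ℤ * + n)
          ≡⟨ same (r + + suc j + 0ℤ * + n) ⟩
        affineOf n (π , r) (r + + suc j + 0ℤ * + n)
          ≡⟨ affineOf-window π r 0ℤ (ℕₚ.<-≤-trans j<d d≤n) ⟩
        r + + suc (⌊ π ⌋ j) + 0ℤ * + n
          ≡⟨ window-wrap r (⌊ π ⌋ j) 0ℤ ⟨
        r + + suc (n ℕ.+ ⌊ π ⌋ j) + (0ℤ - 1ℤ) * + n ∎)) (ℕₚ.+-comm n _)

  neg-shift : ∀ {d p q} → d ℕ.+ p ≡ q → - + p ≡ - + q + + d
  neg-shift {d} {p} refl = solve (+ d) (+ p)
    where
    solve : ∀ (D P : ℤ) → - P ≡ - (D + P) + D
    solve = solve-∀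

  shift-representative : ∀ π r → ∃ λ p₀ → p₀ < n × SameAffine n (π , - + p₀) (π , r)
  shift-representative π r = a %ℕ n , n%ℕd<d a n , λ z → begin
    affineOf n (π , - + (a %ℕ n)) z                          ≡⟨ sameAffine-period π (- + (a %ℕ n)) (- (a /ℕ n)) z ⟨
    affineOf n (π , - + (a %ℕ n) + - (a /ℕ n) * + n) z       ≡⟨ cong (λ s → affineOf n (π , s) z) r≡ ⟨
    affineOf n (π , r) z                                     ∎
    where
    a : ℤ
    a = - r

    negate : ∀ (R P Q N : ℤ) → - R ≡ P + Q * N → R ≡ - P + - Q * N
    negate R P Q N eq = trans (solve R) (trans (cong -_ eq) (solve′ P Q N))
      where
      solve : ∀ (R : ℤ) → R ≡ - - R
      solve = solve-∀

      solve′ : ∀ (P Q N : ℤ) → - (P + Q * N) ≡ - P + - Q * N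
      solve′ = solve-∀

    r≡ : r ≡ - + (a %ℕ n) + - (a /ℕ n) * + n
    r≡ = negate r (+ (a %ℕ n)) (a /ℕ n) (+ n) (a≡a%ℕn+[a/ℕn]*n a n)

module Bijection (n : ℕ) .{{_ : NonZero n}} where
  open AffinePermutations n
  open import Data.Nat as ℕ using (_<_; _≤_; _∸_; z≤n; s≤s)
  open import Data.Nat.Properties using (≤-trans; <⇒≤; m∸n≤m; m∸n+n≡m; m+[n∸m]≡n; m<n⇒0<n∸m; m<m+n; +-monoʳ-≤; <-cmp)
  open import Data.Integer using (ℤ; +_; -_; _+_)
  open import Data.Integer.Properties using (+-identityʳ)
  open ≡-Reasoning

  max : Fin (suc n)
  max = Fin.fromℕ n

  maxPos : Permutation′ (suc n) → Fin (suc n)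
  maxPos τ = τ ⟨$⟩ˡ max

  maxPos-unique : ∀ τ {p} → τ ⟨$⟩ʳ p ≡ max → maxPos τ ≡ p
  maxPos-unique τ τp≡max = trans (cong (τ ⟨$⟩ˡ_) (sym τp≡max)) (inverseˡ τ)

  Φ : Permutation′ (suc n) → Permutation′ n × ℤ
  Φ τ = remove (maxPos τ) τ , - + toℕ (maxPos τ)

  Φ-at : ∀ τ {p} → τ ⟨$⟩ʳ p ≡ max → Φ τ ≡ (remove p τ , - + toℕ p)
  Φ-at τ τp≡max = cong (λ q → remove q τ , - + toℕ q) (maxPos-unique τ τp≡max)

  Φ-insert : ∀ σ pos → SameAffine n (Φ (insert pos max σ)) (σ , - + toℕ pos)
  Φ-insert σ pos z = begin
    affineOf n (Φ τ) z                        ≡⟨ cong (λ q → affineOf n q z) (Φ-at τ (insert-at pos max σ)) ⟩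
    affineOf n (remove pos τ , - + toℕ pos) z ≡⟨ sameAffine-cong (remove pos τ) σ _ (remove-insert pos max σ) z ⟩
    affineOf n (σ , - + toℕ pos) z            ∎
    where
    τ : Permutation′ (suc n)
    τ = insert pos max σ

  Φ-cong : ∀ τ τ′ → SamePerm τ τ′ → SameAffine n (Φ τ) (Φ τ′)
  Φ-cong τ τ′ τ≈τ′ z = begin
    affineOf n (Φ τ) z
      ≡⟨ sameAffine-cong (remove (maxPos τ) τ) (remove (maxPos τ) τ′) _ (remove-cong (maxPos τ) τ τ′ τ≈τ′) z ⟩
    affineOf n (remove (maxPos τ) τ′ , - + toℕ (maxPos τ)) z
      ≡⟨ cong (λ q → affineOf n q z) (Φ-at τ′ (trans (sym (τ≈τ′ _)) (inverseʳ τ))) ⟨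
    affineOf n (Φ τ′) z ∎

  Φ-<-decomposable : ∀ τ τ′ → toℕ (maxPos τ) < toℕ (maxPos τ′) → SameAffine n (Φ τ) (Φ τ′) → SumDecomposable τ′
  Φ-<-decomposable τ τ′ p<p′ same =
    removeMax-splitsAt⇒sumDecomposable τ′ (maxPos τ′) (inverseʳ τ′) (m<n⇒0<n∸m p<p′) (m∸n≤m p′ p) rest-splits
    where
    p p′ : ℕ
    p = toℕ (maxPos τ)
    p′ = toℕ (maxPos τ′)

    d≤n : p′ ∸ p ≤ n
    d≤n = ≤-trans (m∸n≤m p′ p) (Finₚ.toℕ≤pred[n] (maxPos τ′))

    same′ : SameAffine n (remove (maxPos τ) τ , - + p′ + + (p′ ∸ p)) (remove (maxPos τ′) τ′ , - + p′)
    same′ z = trans (cong (λ s → affineOf n (remove (maxPos τ) τ , s) z) (sym (neg-shift (m∸n+n≡m (<⇒≤ p<p′))))) (same z)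

    rest-splits : SplitsAt (remove (maxPos τ′) τ′) (p′ ∸ p)
    rest-splits =
      isRotation⇒splitsAt d≤n (sameAffine⇒isRotation (remove (maxPos τ) τ) (remove (maxPos τ′) τ′) (- + p′) d≤n same′)

  Φ-injective : ∀ τ τ′ → SumIndecomposable τ → SumIndecomposable τ′ → SameAffine n (Φ τ) (Φ τ′) → SamePerm τ τ′
  Φ-injective τ τ′ indec indec′ same with <-cmp (toℕ (maxPos τ)) (toℕ (maxPos τ′))
  ... | tri< p<p′ _ _ = contradiction (Φ-<-decomposable τ τ′ p<p′ same) indec′
  ... | tri> _ _ p′<p = contradiction (Φ-<-decomposable τ′ τ p′<p (λ z → sym (same z))) indec
  ... | tri≈ _ p≡p′ _ = remove-injective p τ τ′ (trans (inverseʳ τ) (sym τ′p≡max))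
                          (isRotation-zero (sameAffine⇒isRotation (remove p τ) (remove p τ′) (- + toℕ p) z≤n same′))
    where
    p : Fin (suc n)
    p = maxPos τ

    τ′p≡max : τ′ ⟨$⟩ʳ p ≡ max
    τ′p≡max = subst (λ q → τ′ ⟨$⟩ʳ q ≡ max) (Finₚ.toℕ-injective (sym p≡p′)) (inverseʳ τ′)

    same′ : SameAffine n (remove p τ , - + toℕ p + + 0) (remove p τ′ , - + toℕ p)
    same′ z = begin
      affineOf n (remove p τ , - + toℕ p + + 0) z  ≡⟨ cong (λ s → affineOf n (remove p τ , s) z) (+-identityʳ _) ⟩
      affineOf n (Φ τ) z                           ≡⟨ same z ⟩
      affineOf n (Φ τ′) z                          ≡⟨ cong (λ q → affineOf n q z) (Φ-at τ′ τ′p≡max) ⟩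
      affineOf n (remove p τ′ , - + toℕ p) z       ∎

  Φ-surjective : ∀ a → AllParams {n} a → ∃ λ τ → SumIndecomposable τ × SameAffine n (Φ τ) a
  Φ-surjective (π , r) _ with shift-representative π r
  ... | p₀ , p₀<n , same₀ with greatest-≤ (splitsAt? π) (splitsAt-zero π) p₀
  ... | d , d≤p₀ , splits , none-above = insert pos max σ , insertMax-indecomposable σ pos no-split , same
    where
    d≤n : d ≤ n
    d≤n = ≤-trans d≤p₀ (<⇒≤ p₀<n)

    σ : Permutation′ n
    σ = rotate d≤n π

    p₀∸d≤n : p₀ ∸ d ≤ n
    p₀∸d≤n = ≤-trans (m∸n≤m p₀ d) (<⇒≤ p₀<n)

    pos : Fin (suc n)
    pos = fromℕ< (s≤s p₀∸d≤n)

    d+pos≡p₀ : d ℕ.+ toℕ pos ≡ p₀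
    d+pos≡p₀ = trans (cong (d ℕ.+_) (Finₚ.toℕ-fromℕ< (s≤s p₀∸d≤n))) (m+[n∸m]≡n d≤p₀)

    no-split : ∀ {e} → 0 < e → e ≤ toℕ pos → ¬ SplitsAt σ e
    no-split {e} 0<e e≤pos σ-splits = none-above (m<m+n d 0<e) d+e≤p₀
      (isRotation-splitsAt-+ (≤-trans d+e≤p₀ (<⇒≤ p₀<n)) (rotate-isRotation d≤n splits) σ-splits)
      where
      d+e≤p₀ : d ℕ.+ e ≤ p₀
      d+e≤p₀ = subst (d ℕ.+ e ≤_) d+pos≡p₀ (+-monoʳ-≤ d e≤pos)

    same : SameAffine n (Φ (insert pos max σ)) (π , r)
    same z = begin
      affineOf n (Φ (insert pos max σ)) z
        ≡⟨ Φ-insert σ pos z ⟩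
      affineOf n (σ , - + toℕ pos) z
        ≡⟨ cong (λ s → affineOf n (σ , s) z) (neg-shift d+pos≡p₀) ⟩
      affineOf n (σ , - + p₀ + + d) z
        ≡⟨ isRotation⇒sameAffine σ π (- + p₀) d≤n (rotate-isRotation d≤n splits) z ⟩
      affineOf n (π , - + p₀) z
        ≡⟨ same₀ z ⟩
      affineOf n (π , r) z ∎

proposition2p6 : (n : ℕ) .{{_ : NonZero n}} →
    ∃ λ m → HasCard (SameAffine n) (AllParams {n}) m
          × HasCard (SamePerm {suc n}) SumIndecomposable m
proposition2p6 n =
  let m , indecomposables = hasCard-fromList (samePerm-isDecEquivalence {suc n}) {P = SumIndecomposable}
                              (λ τ → ¬? (sumDecomposable? τ)) sumIndecomposable-resp
                              (permutations (suc n)) permutations-complete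
  in m , hasCard-transfer (λ s t z → trans (s z) (t z)) Φ (λ _ _ → tt) Φ-injective Φ-surjective Φ-cong indecomposables
       , indecomposables
  where open Bijection n
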